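{- Let $M=(E,\mathcal{B})$ be an antisymmetric matroid on $E=[n]\cup[n]^*$ with $\mathcal{T}_n\subseteq\mathcal{B}$. Then $\mathcal{A}_n\setminus\mathcal{B}$ is a gaussoid.
   Context: $E=[n]\cup[n]^*$ with involution $i\leftrightarrow i^*$; a skew pair is $\{i,i^*\}$; $\mathcal{T}_n$ (transversals) are $n$-subsets of $E$ with no skew pair, $\mathcal{A}_n$ (almost-transversals) $n$-subsets with exactly one skew pair. An antisymmetric matroid on $E$ is $(E,\mathcal{B})$ with $\mathcal{B}\subseteq\mathcal{T}_n\cup\mathcal{A}_n$ satisfying (B1) $\mathcal{B}\ne\emptyset$; (B2) for $T\in\mathcal{T}_n$ and distinct skew pairs $p,q$, $(T\cup p)\setminus q\in\mathcal{B}$ iff $(T\cup q)\setminus p\in\mathcal{B}$; (Exch) for $B,B'\in\mathcal{B}$ and $e\in B\setminus B'$ with $B\setminus\{e\}$ having no skew pair and $B'\cup\{e\}$ having exactly one skew pair, there is $f\in B'\setminus B$ with both $(B\setminus\{e\})\cup\{f\}$ and $(B'\cup\{e\})\setminus\{f\}$ in $\mathcal{B}$. A subset $\mathcal{G}\subseteq\mathcal{A}_n$ is allowable if for every $A\in\mathcal{A}_n$, with $p$ the skew pair contained in $A$ and $q$ the skew pair disjoint from $A$, $A\in\mathcal{G}$ iff $(A\setminus p)\cup q\in\mathcal{G}$. For a transversal $S\cup\{a,b,c\}$ with $S\cap\{a,b,c\}=\emptyset$, the associated edge relation has three terms indexed by the pairs $(S\cup\{a,b,c\},S\cup\{b,b^*,c^*\})$,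 $(S\cup\{a,b,c^*\},S\cup\{b,b^*,c\})$, $(S\cup\{a,b,b^*\},S\cup\{b,c,c^*\})$. An allowable $\mathcal{G}$ is incompatible with this edge relation if there is exactly one of these three pairs neither of whose members lies in $\mathcal{G}$; otherwise it is compatible. A gaussoid is an allowable $\mathcal{G}\subseteq\mathcal{A}_n$ compatible with all edge relations. -}

module Defs where

open import Data.Nat using (ℕ; zero; suc; _+_)
open import Data.Bool using (Bool; true; false; not; _∧_; if_then_else_)
open import Data.Fin using (Fin)
open import Data.Vec using (Vec; lookup; updateAt; _[_]≔_; map; sum)
open import Data.Product using (_×_; _,_; proj₁; proj₂; ∃; ∃-syntax)
open import Data.Sum using (_⊎_)
open import Relation.Nullary using (¬_)
open import Relation.Binary.PropositionalEquality using (_≡_; _≢_)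

-- The ground set E = [n] ∪ [n]* : (i , false) stands for i, (i , true) for i*.
Elem : ℕ → Set
Elem n = Fin n × Bool

_* : ∀ {n} → Elem n → Elem n
(i , b) * = (i , not b)

-- A subset A of E is recorded coordinatewise:
-- lookup A i = (i ∈ A , i* ∈ A).
SubE : ℕ → Set
SubE n = Vec (Bool × Bool) n

pick : Bool → Bool × Bool → Bool
pick false = proj₁
pick true  = proj₂

setPick : Bool → Bool → Bool × Bool → Bool × Bool
setPick false v (x , y) = (v , y)
setPick true  v (x , y) = (x , v)

_∈E_ : ∀ {n} → Elem n → SubE n → Set
(i , b) ∈E A = pick b (lookup A i) ≡ true

insertE : ∀ {n} → Elem n → SubE n → SubE n
insertE (i , b) A = updateAt A i (setPick b true)

removeE : ∀ {n} → Elem n → SubE n → SubE n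
removeE (i , b) A = updateAt A i (setPick b false)

addPair : ∀ {n} → Fin n → SubE n → SubE n
addPair i A = A [ i ]≔ (true , true)

removePair : ∀ {n} → Fin n → SubE n → SubE n
removePair i A = A [ i ]≔ (false , false)

PairIn : ∀ {n} → Fin n → SubE n → Set
PairIn i A = lookup A i ≡ (true , true)

PairDisjoint : ∀ {n} → Fin n → SubE n → Set
PairDisjoint i A = lookup A i ≡ (false , false)

b2n : Bool → ℕ
b2n true  = 1
b2n false = 0

card : ∀ {n} → SubE n → ℕ
card A = sum (map (λ p → b2n (proj₁ p) + b2n (proj₂ p)) A)

skewCount : ∀ {n} → SubE n → ℕ
skewCount A = sum (map (λ p → b2n (proj₁ p ∧ proj₂ p)) A)

IsTransversal : ∀ {n} → SubE n → Set
IsTransversal {n} A = card A ≡ n × skewCount A ≡ 0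

IsAlmostTransversal : ∀ {n} → SubE n → Set
IsAlmostTransversal {n} A = card A ≡ n × skewCount A ≡ 1

Family : ℕ → Set₁
Family n = SubE n → Set

_⇔'_ : Set → Set → Set
P ⇔' Q = (P → Q) × (Q → P)

record IsAntisymmetricMatroid {n : ℕ} (𝓑 : Family n) : Set where
  field
    bases-⊆ : ∀ B → 𝓑 B → IsTransversal B ⊎ IsAlmostTransversal B
    B1 : ∃[ B ] 𝓑 B
    B2 : ∀ (T : SubE n) → IsTransversal T → ∀ (p q : Fin n) → p ≢ q →
         𝓑 (removePair q (addPair p T)) ⇔' 𝓑 (removePair p (addPair q T))
    Exch : ∀ B B' → 𝓑 B → 𝓑 B' → ∀ (e : Elem n) → e ∈E B → ¬ (e ∈E B') →
           skewCount (removeE e B) ≡ 0 → skewCount (insertE e B') ≡ 1 →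
           ∃[ f ] (f ∈E B' × ¬ (f ∈E B) ×
                   𝓑 (insertE f (removeE e B)) × 𝓑 (removeE f (insertE e B')))

almostMinus : ∀ {n} → Family n → Family n
almostMinus 𝓑 A = IsAlmostTransversal A × ¬ 𝓑 A

IsAllowable : ∀ {n} → Family n → Set
IsAllowable {n} 𝒢 =
  (∀ A → 𝒢 A → IsAlmostTransversal A) ×
  (∀ (A : SubE n) (p q : Fin n) → IsAlmostTransversal A → PairIn p A → PairDisjoint q A →
     𝒢 A ⇔' 𝒢 (addPair q (removePair p A)))

Neither : ∀ {n} → Family n → SubE n → SubE n → Set
Neither 𝒢 X Y = ¬ 𝒢 X × ¬ 𝒢 Y

ExactlyOne : Set → Set → Set → Set
ExactlyOne P Q R = (P × ¬ Q × ¬ R) ⊎ (¬ P × Q × ¬ R) ⊎ (¬ P × ¬ Q × R)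

ins3 : ∀ {n} → Elem n → Elem n → Elem n → SubE n → SubE n
ins3 x y z S = insertE x (insertE y (insertE z S))

Incompatible : ∀ {n} → Family n → SubE n → Elem n → Elem n → Elem n → Set
Incompatible 𝒢 S a b c =
  ExactlyOne (Neither 𝒢 (ins3 a b c S)     (ins3 b (b *) (c *) S))
             (Neither 𝒢 (ins3 a b (c *) S) (ins3 b (b *) c S))
             (Neither 𝒢 (ins3 a b (b *) S) (ins3 b c (c *) S))

IsGaussoid : ∀ {n} → Family n → Set
IsGaussoid {n} 𝒢 =
  IsAllowable 𝒢 ×
  (∀ (S : SubE n) (a b c : Elem n) →
     a ≢ b → a ≢ c → b ≢ c →
     ¬ (a ∈E S) → ¬ (b ∈E S) → ¬ (c ∈E S) →
     IsTransversal (ins3 a b c S) →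
     ¬ Incompatible 𝒢 S a b c)

module Submission where

-- Both gaussoid axioms only concern a few skew pairs: allowability the pairs p and q, an edge
-- relation the pairs of a, b and c.  Freezing all other coordinates (to A ∖ p, resp. to S) gives a
-- minor of 𝓑 on two, resp. three, skew pairs, which is again an antisymmetric matroid containing
-- all transversals.  On two pairs, allowability is the axiom B2.  On three pairs, since the
-- transversal members of the edge relation are bases, "neither member lies in 𝒜ₙ ∖ 𝓑" says that
-- its almost-transversal members are bases, and each of these three conditions implies one of the
-- other two, by exchanges (Exch) between pair swaps (B2); the relabelling c ↔ c* interchanges the
-- first two conditions.

open import Defs
open import Data.Bool using (Bool; true; false; not; _∧_; _xor_)
open import Data.Bool.Properties using (∧-comm; ¬-not; xor-assoc; xor-same; xor-identityʳ)
open import Data.Fin using (Fin; zero; suc)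
open import Data.Fin.Properties using (_≟_)
open import Data.Nat using (ℕ; _+_)
open import Data.Nat.Properties
  using (+-comm; +-assoc; +-identityʳ; +-cancelˡ-≡; +-cancelʳ-≡; m+n≡0⇒n≡0; +-commutativeSemigroup)
open import Algebra.Properties.CommutativeSemigroup +-commutativeSemigroup using (xy∙z≈zy∙x; xy∙z≈x∙zy)
open import Data.Product using (_×_; _,_; proj₁; proj₂; ∃-syntax; swap; map₁)
import Data.Product as Product
open import Data.Sum using (_⊎_; inj₁; inj₂; [_,_]′)
import Data.Sum as Sum
open import Data.Vec using (Vec; []; _∷_; lookup; updateAt; _[_]≔_; map; sum; replicate)
open import Data.Vec.Properties
  using ( lookup∘updateAt; lookup∘updateAt′; lookup∘update; lookup∘update′
        ; updateAt-updateAt-local; updateAt-commutes; []≔-lookup; []≔-idempotent)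
open import Data.Vec.Relation.Unary.All using (All; []; _∷_)
open import Data.Vec.Relation.Unary.All.Properties using (lookup⁺)
open import Data.Vec.Relation.Unary.AllPairs using (AllPairs; []; _∷_)
open import Function using (_∘_)
open import Relation.Nullary using (¬_; yes; no; contradiction)
open import Relation.Binary.PropositionalEquality

none pos both : Bool × Bool
none = false , false
pos  = true  , false
both = true  , true

size skew : Bool × Bool → ℕ
size v = b2n (proj₁ v) + b2n (proj₂ v)
skew v = b2n (proj₁ v ∧ proj₂ v)

∅ : ∀ {k} → SubE k
∅ = replicate _ none

orient : Bool → Bool × Bool → Bool × Bool
orient false v = v
orient true  v = swap v

orient-none : ∀ s → orient s none ≡ none
orient-none false = refl
orient-none true  = refl

orient-both : ∀ s → orient s both ≡ both
orient-both false = refl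
orient-both true  = refl

size-orient : ∀ s v → size (orient s v) ≡ size v
size-orient false v = refl
size-orient true  v = +-comm (b2n (proj₂ v)) (b2n (proj₁ v))

skew-orient : ∀ s v → skew (orient s v) ≡ skew v
skew-orient false v = refl
skew-orient true  v = cong b2n (∧-comm (proj₂ v) (proj₁ v))

pick-orient : ∀ s u v → pick (u xor s) (orient s v) ≡ pick u v
pick-orient false false v = refl
pick-orient false true  v = refl
pick-orient true  false v = refl
pick-orient true  true  v = refl

setPick-orient : ∀ s u b v → setPick (u xor s) b (orient s v) ≡ orient s (setPick u b v)
setPick-orient false false b (x , y) = refl
setPick-orient false true  b (x , y) = refl
setPick-orient true  false b (x , y) = refl
setPick-orient true  true  b (x , y) = refl

pick-setPick : ∀ s v → pick s (setPick s true v) ≡ true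
pick-setPick false (x , y) = refl
pick-setPick true  (x , y) = refl

pick-setPick⁺ : ∀ s t v → pick t v ≡ true → pick t (setPick s true v) ≡ true
pick-setPick⁺ false false (x , y) t∈ = refl
pick-setPick⁺ false true  (x , y) t∈ = t∈
pick-setPick⁺ true  false (x , y) t∈ = t∈
pick-setPick⁺ true  true  (x , y) t∈ = refl

pick-pick-not⇒both : ∀ s v → pick s v ≡ true → pick (not s) v ≡ true → v ≡ both
pick-pick-not⇒both false (true , true) _ _ = refl
pick-pick-not⇒both true  (true , true) _ _ = refl

¬pick-¬pick-not⇒none : ∀ s v → ¬ pick s v ≡ true → ¬ pick (not s) v ≡ true → v ≡ none
¬pick-¬pick-not⇒none false (false , false) _ _ = refl
¬pick-¬pick-not⇒none false (true  , _)     ∉ _ = contradiction refl ∉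
¬pick-¬pick-not⇒none false (false , true)  _ ∉ = contradiction refl ∉
¬pick-¬pick-not⇒none true  (false , false) _ _ = refl
¬pick-¬pick-not⇒none true  (_ , true)      ∉ _ = contradiction refl ∉
¬pick-¬pick-not⇒none true  (true , false)  _ ∉ = contradiction refl ∉

sum-map-[]≔ : ∀ {A : Set} {k} (f : A → ℕ) (xs : Vec A k) i y →
              sum (map f (xs [ i ]≔ y)) + f (lookup xs i) ≡ sum (map f xs) + f y
sum-map-[]≔ f (x ∷ xs) zero    y = xy∙z≈zy∙x (f y) (sum (map f xs)) (f x)
sum-map-[]≔ f (x ∷ xs) (suc i) y = begin
  f x + sum (map f (xs [ i ]≔ y)) + f (lookup xs i)   ≡⟨ +-assoc (f x) _ _ ⟩
  f x + (sum (map f (xs [ i ]≔ y)) + f (lookup xs i)) ≡⟨ cong (f x +_) (sum-map-[]≔ f xs i y) ⟩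
  f x + (sum (map f xs) + f y)                        ≡⟨ +-assoc (f x) _ _ ⟨
  f x + sum (map f xs) + f y                          ∎
  where open ≡-Reasoning

skewCount≡0⇒¬PairIn : ∀ {n} (A : SubE n) i → skewCount A ≡ 0 → ¬ PairIn i A
skewCount≡0⇒¬PairIn (_ ∷ A) zero    A-skew refl = contradiction A-skew λ ()
skewCount≡0⇒¬PairIn (v ∷ A) (suc i) A-skew      = skewCount≡0⇒¬PairIn A i (m+n≡0⇒n≡0 (skew v) A-skew)

module _ {n : ℕ} where

  ∈-insertE : ∀ x (A : SubE n) → x ∈E insertE x A
  ∈-insertE (i , s) A = trans (cong (pick s) (lookup∘updateAt i A)) (pick-setPick s (lookup A i))

  ∈-insertE⁺ : ∀ x (A : SubE n) y → y ∈E A → y ∈E insertE x A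
  ∈-insertE⁺ (i , s) A (l , t) y∈ with l ≟ i
  ... | yes refl = trans (cong (pick t) (lookup∘updateAt i A)) (pick-setPick⁺ s t (lookup A i) y∈)
  ... | no l≢i   = trans (cong (pick t) (lookup∘updateAt′ l i l≢i A)) y∈

  ∈-∈*⇒PairIn : ∀ x (A : SubE n) → x ∈E A → (x *) ∈E A → PairIn (proj₁ x) A
  ∈-∈*⇒PairIn (i , s) A = pick-pick-not⇒both s (lookup A i)

  ∉-∉*⇒PairDisjoint : ∀ x (A : SubE n) → ¬ x ∈E A → ¬ (x *) ∈E A → PairDisjoint (proj₁ x) A
  ∉-∉*⇒PairDisjoint (i , s) A = ¬pick-¬pick-not⇒none s (lookup A i)

  samePair⇒* : ∀ {x y : Elem n} → proj₁ x ≡ proj₁ y → x ≢ y → y ≡ x *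
  samePair⇒* {i , s} {.i , t} refl x≢y = cong (i ,_) (¬-not (x≢y ∘ cong (i ,_) ∘ sym))

-- frame S es A is S with the m-th skew pair of E_k written onto the skew pair of lookup es m,
-- oriented so that the local element (m , false) becomes lookup es m itself (see embed).
module _ {n : ℕ} where

  embed : ∀ {k} → Vec (Elem n) k → Elem k → Elem n
  embed es (m , u) = proj₁ (lookup es m) , u xor proj₂ (lookup es m)

  frame : ∀ {k} → SubE n → Vec (Elem n) k → SubE k → SubE n
  frame S []             []      = S
  frame S ((i , s) ∷ es) (v ∷ A) = frame S es A [ i ]≔ orient s v

  DistinctPairs : ∀ {k} → Vec (Elem n) k → Set
  DistinctPairs = AllPairs (λ e e′ → proj₁ e ≢ proj₁ e′)

  PairsDisjoint : ∀ {k} → SubE n → Vec (Elem n) k → Set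
  PairsDisjoint S = All (λ e → PairDisjoint (proj₁ e) S)

  distinct-lookup : ∀ {k} {es : Vec (Elem n) k} → DistinctPairs es →
                    ∀ {m m′} → m ≢ m′ → proj₁ (lookup es m) ≢ proj₁ (lookup es m′)
  distinct-lookup (d ∷ ds) {zero}  {zero}   m≢m′ = contradiction refl m≢m′
  distinct-lookup (d ∷ ds) {zero}  {suc m′} _    = lookup⁺ d m′
  distinct-lookup (d ∷ ds) {suc m} {zero}   _    = ≢-sym (lookup⁺ d m)
  distinct-lookup (d ∷ ds) {suc m} {suc m′} m≢m′ = distinct-lookup ds (m≢m′ ∘ cong suc)

  module _ {S : SubE n} where

    lookup-frame-outside : ∀ {k} {es : Vec (Elem n) k} A {l} → All (λ e → l ≢ proj₁ e) es →
                           lookup (frame S es A) l ≡ lookup S l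
    lookup-frame-outside {es = []}          []      []          = refl
    lookup-frame-outside {es = (i , s) ∷ es} (v ∷ A) (l≢i ∷ ps) =
      trans (lookup∘updateAt′ _ i l≢i (frame S es A)) (lookup-frame-outside A ps)

    lookup-frame : ∀ {k} {es : Vec (Elem n) k} → DistinctPairs es → ∀ A m →
                   lookup (frame S es A) (proj₁ (lookup es m)) ≡ orient (proj₂ (lookup es m)) (lookup A m)
    lookup-frame {es = (i , s) ∷ es} _        (v ∷ A) zero    = lookup∘updateAt i (frame S es A)
    lookup-frame {es = (i , s) ∷ es} (d ∷ ds) (v ∷ A) (suc m) =
      trans (lookup∘updateAt′ _ i (≢-sym (lookup⁺ d m)) (frame S es A)) (lookup-frame ds A m)

    updateAt-frame : ∀ {k} {es : Vec (Elem n) k} → DistinctPairs es → ∀ A m {g h} →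
                     (∀ v → g (orient (proj₂ (lookup es m)) v) ≡ orient (proj₂ (lookup es m)) (h v)) →
                     updateAt (frame S es A) (proj₁ (lookup es m)) g ≡ frame S es (updateAt A m h)
    updateAt-frame {es = (i , s) ∷ es} _        (v ∷ A) zero    gh = updateAt-updateAt-local i (frame S es A) (gh v)
    updateAt-frame {es = (i , s) ∷ es} (d ∷ ds) (v ∷ A) (suc m) gh =
      trans (updateAt-commutes _ i (≢-sym (lookup⁺ d m)) (frame S es A))
            (cong (_[ i ]≔ orient s v) (updateAt-frame ds A m gh))

    sum-frame : (f : Bool × Bool → ℕ) → f none ≡ 0 → (∀ s v → f (orient s v) ≡ f v) →
                ∀ {k} {es : Vec (Elem n) k} → DistinctPairs es → PairsDisjoint S es →
                ∀ A → sum (map f (frame S es A)) ≡ sum (map f S) + sum (map f A)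
    sum-frame f f-none f-orient {es = []}          []       []        []      = sym (+-identityʳ _)
    sum-frame f f-none f-orient {es = (i , s) ∷ es} (d ∷ ds) (Si ∷ Ss) (v ∷ A) = begin
      sum (map f (F [ i ]≔ orient s v))                  ≡⟨ +-identityʳ _ ⟨
      sum (map f (F [ i ]≔ orient s v)) + 0              ≡⟨ cong (sum (map f (F [ i ]≔ orient s v)) +_) F-i ⟨
      sum (map f (F [ i ]≔ orient s v)) + f (lookup F i) ≡⟨ sum-map-[]≔ f F i (orient s v) ⟩
      sum (map f F) + f (orient s v)                     ≡⟨ cong₂ _+_ (sum-frame f f-none f-orient ds Ss A) (f-orient s v) ⟩
      sum (map f S) + sum (map f A) + f v                ≡⟨ xy∙z≈x∙zy (sum (map f S)) (sum (map f A)) (f v) ⟩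
      sum (map f S) + (f v + sum (map f A))              ∎
      where
      open ≡-Reasoning
      F = frame S es A
      F-i : f (lookup F i) ≡ 0
      F-i = trans (cong f (trans (lookup-frame-outside A d) Si)) f-none

    frame-∅ : ∀ {k} {es : Vec (Elem n) k} → PairsDisjoint S es → frame S es ∅ ≡ S
    frame-∅ {es = []}          []        = refl
    frame-∅ {es = (i , s) ∷ es} (Si ∷ Ss) = begin
      frame S es ∅ [ i ]≔ orient s none ≡⟨ cong₂ (λ X w → X [ i ]≔ w) (frame-∅ Ss) (orient-none s) ⟩
      S [ i ]≔ none                     ≡⟨ cong (S [ i ]≔_) Si ⟨
      S [ i ]≔ lookup S i               ≡⟨ []≔-lookup S i ⟩
      S                                 ∎
      where open ≡-Reasoning

    ∈-frame-∖⇒embedded : ∀ {k} (es : Vec (Elem n) k) A A′ {f} →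
                         f ∈E frame S es A′ → ¬ f ∈E frame S es A → ∃[ x ] f ≡ embed es x
    ∈-frame-∖⇒embedded []             []      []        f∈ f∉ = contradiction f∈ f∉
    ∈-frame-∖⇒embedded ((i , s) ∷ es) (v ∷ A) (v′ ∷ A′) {l , t} f∈ f∉ with l ≟ i
    ... | yes refl = (zero , t xor s) , cong (l ,_) (sym xor-cancelʳ)
      where
      xor-cancelʳ : (t xor s) xor s ≡ t
      xor-cancelʳ = trans (xor-assoc t s s) (trans (cong (t xor_) (xor-same s)) (xor-identityʳ t))
    ... | no l≢i =
      let (m , u) , f≡ = ∈-frame-∖⇒embedded es A A′ (subst (λ w → pick t w ≡ true) (lookup-tail A′) f∈)
                                                    (f∉ ∘ subst (λ w → pick t w ≡ true) (sym (lookup-tail A)))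
      in (suc m , u) , f≡
      where
      lookup-tail : ∀ {w} B → lookup (frame S es B [ i ]≔ w) l ≡ lookup (frame S es B) l
      lookup-tail B = lookup∘updateAt′ l i l≢i (frame S es B)

module Frame {n k} (S : SubE n) {es : Vec (Elem n) k} (distinct : DistinctPairs es) (disjoint : PairsDisjoint S es) where

  ⟦_⟧ : SubE k → SubE n
  ⟦_⟧ = frame S es

  φ : Elem k → Elem n
  φ = embed es

  ι : Fin k → Fin n
  ι m = proj₁ (lookup es m)

  σ : Fin k → Bool
  σ m = proj₂ (lookup es m)

  insertE-frame : ∀ x A → insertE (φ x) ⟦ A ⟧ ≡ ⟦ insertE x A ⟧
  insertE-frame (m , u) A = updateAt-frame distinct A m (setPick-orient (σ m) u true)

  removeE-frame : ∀ x A → removeE (φ x) ⟦ A ⟧ ≡ ⟦ removeE x A ⟧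
  removeE-frame (m , u) A = updateAt-frame distinct A m (setPick-orient (σ m) u false)

  addPair-frame : ∀ m A → addPair (ι m) ⟦ A ⟧ ≡ ⟦ addPair m A ⟧
  addPair-frame m A = updateAt-frame distinct A m (λ _ → sym (orient-both (σ m)))

  removePair-frame : ∀ m A → removePair (ι m) ⟦ A ⟧ ≡ ⟦ removePair m A ⟧
  removePair-frame m A = updateAt-frame distinct A m (λ _ → sym (orient-none (σ m)))

  card-frame : ∀ A → card ⟦ A ⟧ ≡ card S + card A
  card-frame = sum-frame size refl size-orient distinct disjoint

  skewCount-frame : ∀ A → skewCount ⟦ A ⟧ ≡ skewCount S + skewCount A
  skewCount-frame = sum-frame skew refl skew-orient distinct disjoint

  pick-frame : ∀ A m u → pick (u xor σ m) (lookup ⟦ A ⟧ (ι m)) ≡ pick u (lookup A m)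
  pick-frame A m u = trans (cong (pick (u xor σ m)) (lookup-frame distinct A m)) (pick-orient (σ m) u (lookup A m))

  ∈-frame⁺ : ∀ x A → x ∈E A → φ x ∈E ⟦ A ⟧
  ∈-frame⁺ (m , u) A x∈ = trans (pick-frame A m u) x∈

  ∈-frame⁻ : ∀ x A → φ x ∈E ⟦ A ⟧ → x ∈E A
  ∈-frame⁻ (m , u) A x∈ = trans (sym (pick-frame A m u)) x∈

  ins3-frame : ∀ x y z → ins3 (φ x) (φ y) (φ z) S ≡ ⟦ ins3 x y z ∅ ⟧
  ins3-frame x y z = begin
    ins3 (φ x) (φ y) (φ z) S                        ≡⟨ cong (ins3 (φ x) (φ y) (φ z)) (frame-∅ disjoint) ⟨
    ins3 (φ x) (φ y) (φ z) ⟦ ∅ ⟧                    ≡⟨ cong (insertE (φ x) ∘ insertE (φ y)) (insertE-frame z ∅) ⟩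
    insertE (φ x) (insertE (φ y) ⟦ insertE z ∅ ⟧)   ≡⟨ cong (insertE (φ x)) (insertE-frame y _) ⟩
    insertE (φ x) ⟦ insertE y (insertE z ∅) ⟧       ≡⟨ insertE-frame x _ ⟩
    ⟦ ins3 x y z ∅ ⟧                                ∎
    where open ≡-Reasoning

  swapPairs-frame : ∀ p q T → removePair (ι q) (addPair (ι p) ⟦ T ⟧) ≡ ⟦ removePair q (addPair p T) ⟧
  swapPairs-frame p q T = trans (cong (removePair (ι q)) (addPair-frame p T)) (removePair-frame q _)

module Minor {n k} (S : SubE n) {es : Vec (Elem n) k} (distinct : DistinctPairs es) (disjoint : PairsDisjoint S es)
             (card-S : card S + k ≡ n) (skewCount-S : skewCount S ≡ 0) where

  open Frame S distinct disjoint public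

  skewCount-frame′ : ∀ A → skewCount ⟦ A ⟧ ≡ skewCount A
  skewCount-frame′ A = trans (skewCount-frame A) (cong (_+ skewCount A) skewCount-S)

  cardSkewCount-frame : ∀ A c → (card ⟦ A ⟧ ≡ n × skewCount ⟦ A ⟧ ≡ c)
                                ⇔' (card A ≡ k × skewCount A ≡ c)
  cardSkewCount-frame A c =
      Product.map (λ h → +-cancelˡ-≡ (card S) _ _ (trans (sym (card-frame A)) (trans h (sym card-S))))
                  (trans (sym (skewCount-frame′ A)))
    , Product.map (λ h → trans (card-frame A) (trans (cong (card S +_) h) card-S))
                  (trans (skewCount-frame′ A))

  transversal-frame : ∀ A → IsTransversal ⟦ A ⟧ ⇔' IsTransversal A
  transversal-frame A = cardSkewCount-frame A 0

  almostTransversal-frame : ∀ A → IsAlmostTransversal ⟦ A ⟧ ⇔' IsAlmostTransversal A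
  almostTransversal-frame A = cardSkewCount-frame A 1

  almostMinus-frame : ∀ (𝓑 : Family n) A → almostMinus 𝓑 ⟦ A ⟧ ⇔' almostMinus (𝓑 ∘ ⟦_⟧) A
  almostMinus-frame 𝓑 A = map₁ (proj₁ (almostTransversal-frame A)) , map₁ (proj₂ (almostTransversal-frame A))

  Neither-frame : ∀ (𝓑 : Family n) x y z x′ y′ z′ →
                  Neither (almostMinus 𝓑) (ins3 (φ x) (φ y) (φ z) S) (ins3 (φ x′) (φ y′) (φ z′) S)
                    ⇔' Neither (almostMinus (𝓑 ∘ ⟦_⟧)) (ins3 x y z ∅) (ins3 x′ y′ z′ ∅)
  Neither-frame 𝓑 x y z x′ y′ z′ rewrite ins3-frame x y z | ins3-frame x′ y′ z′ =
      Product.map (_∘ proj₂ (G (ins3 x y z ∅))) (_∘ proj₂ (G (ins3 x′ y′ z′ ∅)))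
    , Product.map (_∘ proj₁ (G (ins3 x y z ∅))) (_∘ proj₁ (G (ins3 x′ y′ z′ ∅)))
    where G = almostMinus-frame 𝓑

  module _ {𝓑 : Family n} (M : IsAntisymmetricMatroid 𝓑) where
    open IsAntisymmetricMatroid M

    minor-B2 : ∀ T → IsTransversal T → ∀ p q → p ≢ q →
               𝓑 ⟦ removePair q (addPair p T) ⟧ ⇔' 𝓑 ⟦ removePair p (addPair q T) ⟧
    minor-B2 T T-transversal p q p≢q =
      subst₂ (λ X Y → 𝓑 X ⇔' 𝓑 Y) (swapPairs-frame p q T) (swapPairs-frame q p T)
             (B2 ⟦ T ⟧ (proj₂ (transversal-frame T) T-transversal) (ι p) (ι q) (distinct-lookup distinct p≢q))

    minor-Exch : ∀ B B′ → 𝓑 ⟦ B ⟧ → 𝓑 ⟦ B′ ⟧ → ∀ e → e ∈E B → ¬ e ∈E B′ →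
                 skewCount (removeE e B) ≡ 0 → skewCount (insertE e B′) ≡ 1 →
                 ∃[ f ] (f ∈E B′ × ¬ f ∈E B ×
                         𝓑 ⟦ insertE f (removeE e B) ⟧ × 𝓑 ⟦ removeE f (insertE e B′) ⟧)
    minor-Exch B B′ b b′ e e∈ e∉ B-e B′+e
      with Exch ⟦ B ⟧ ⟦ B′ ⟧ b b′ (φ e) (∈-frame⁺ e B e∈) (e∉ ∘ ∈-frame⁻ e B′)
                (trans (cong skewCount (removeE-frame e B)) (trans (skewCount-frame′ _) B-e))
                (trans (cong skewCount (insertE-frame e B′)) (trans (skewCount-frame′ _) B′+e))
    ... | f , f∈ , f∉ , b₁ , b₂ with ∈-frame-∖⇒embedded es B B′ {f} f∈ f∉
    ... | x , refl =
      x , ∈-frame⁻ x B′ f∈ , f∉ ∘ ∈-frame⁺ x B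
        , subst 𝓑 (trans (cong (insertE (φ x)) (removeE-frame e B)) (insertE-frame x _)) b₁
        , subst 𝓑 (trans (cong (removeE (φ x)) (insertE-frame e B′)) (removeE-frame x _)) b₂

    minor-isAntisymmetricMatroid : ∃[ A ] 𝓑 ⟦ A ⟧ → IsAntisymmetricMatroid (𝓑 ∘ ⟦_⟧)
    minor-isAntisymmetricMatroid base = record
      { bases-⊆ = λ B b → Sum.map (proj₁ (transversal-frame B)) (proj₁ (almostTransversal-frame B))
                                  (bases-⊆ ⟦ B ⟧ b)
      ; B1      = base
      ; B2      = minor-B2
      ; Exch    = minor-Exch
      }

ExactlyOne-map : ∀ {P Q R P′ Q′ R′ : Set} → P ⇔' P′ → Q ⇔' Q′ → R ⇔' R′ →
                 ExactlyOne P Q R → ExactlyOne P′ Q′ R′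
ExactlyOne-map (p , p′) (q , q′) (r , r′) =
  Sum.map (Product.map p (Product.map (_∘ q′) (_∘ r′)))
          (Sum.map (Product.map (_∘ p′) (Product.map q (_∘ r′)))
                   (Product.map (_∘ p′) (Product.map (_∘ q′) r)))

¬ExactlyOne : ∀ {P₁ P₂ P₃ Q₁ Q₂ Q₃ : Set} →
              (¬ P₁) ⇔' (¬ Q₁) → (¬ P₂) ⇔' (¬ Q₂) → (¬ P₃) ⇔' (¬ Q₃) →
              (Q₁ → Q₂ ⊎ Q₃) → (Q₂ → Q₁ ⊎ Q₃) → (Q₃ → Q₁ ⊎ Q₂) → ¬ ExactlyOne P₁ P₂ P₃
¬ExactlyOne (_ , ¬Q₁⇒) (¬P₂⇒ , _) (¬P₃⇒ , _) q₁ _ _ (inj₁ (p₁ , ¬p₂ , ¬p₃)) =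
  ¬Q₁⇒ ([ ¬P₂⇒ ¬p₂ , ¬P₃⇒ ¬p₃ ]′ ∘ q₁) p₁
¬ExactlyOne (¬P₁⇒ , _) (_ , ¬Q₂⇒) (¬P₃⇒ , _) _ q₂ _ (inj₂ (inj₁ (¬p₁ , p₂ , ¬p₃))) =
  ¬Q₂⇒ ([ ¬P₁⇒ ¬p₁ , ¬P₃⇒ ¬p₃ ]′ ∘ q₂) p₂
¬ExactlyOne (¬P₁⇒ , _) (¬P₂⇒ , _) (_ , ¬Q₃⇒) _ _ q₃ (inj₂ (inj₂ (¬p₁ , ¬p₂ , p₃))) =
  ¬Q₃⇒ ([ ¬P₁⇒ ¬p₁ , ¬P₂⇒ ¬p₂ ]′ ∘ q₃) p₃

module _ {n} {𝓑 : Family n} where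

  almostMinus-⇔ : ∀ {X Y} → IsAlmostTransversal X → IsAlmostTransversal Y →
                  𝓑 X ⇔' 𝓑 Y → almostMinus 𝓑 X ⇔' almostMinus 𝓑 Y
  almostMinus-⇔ X-almost Y-almost (X⇒Y , Y⇒X) =
    (λ (_ , ¬bX) → Y-almost , ¬bX ∘ Y⇒X) , (λ (_ , ¬bY) → X-almost , ¬bY ∘ X⇒Y)

  ¬almostMinus⇒¬¬ : ∀ {X} → IsAlmostTransversal X ⊎ 𝓑 X → ¬ almostMinus 𝓑 X → ¬ ¬ 𝓑 X
  ¬almostMinus⇒¬¬ (inj₁ X-almost) ¬g ¬b = ¬g (X-almost , ¬b)
  ¬almostMinus⇒¬¬ (inj₂ b)        _  ¬b = ¬b b

  -- ¬ almostMinus 𝓑 X only yields ¬ ¬ 𝓑 X, hence an equivalence of negations.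
  ¬Neither⇔ : ∀ {X Y} → IsAlmostTransversal X ⊎ 𝓑 X → IsAlmostTransversal Y ⊎ 𝓑 Y →
              (¬ Neither (almostMinus 𝓑) X Y) ⇔' (¬ (𝓑 X × 𝓑 Y))
  ¬Neither⇔ X⁺ Y⁺ = (λ ¬N (bX , bY) → ¬N ((λ g → proj₂ g bX) , (λ g → proj₂ g bY)))
                  , (λ ¬B (¬gX , ¬gY) → ¬almostMinus⇒¬¬ X⁺ ¬gX λ bX →
                                         ¬almostMinus⇒¬¬ Y⁺ ¬gY λ bY → ¬B (bX , bY))

almostMinus-swapPair : ∀ {n} {𝓑 : Family n} → IsAntisymmetricMatroid 𝓑 →
                       ∀ A p q → IsAlmostTransversal A → PairIn p A → PairDisjoint q A →
                       almostMinus 𝓑 A ⇔' almostMinus 𝓑 (addPair q (removePair p A))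
almostMinus-swapPair {n} {𝓑} M A p q (A-card , A-skewCount) p∈A q∉A =
  subst₂ (λ X Y → almostMinus 𝓑 X ⇔' almostMinus 𝓑 Y) (sym A≡) (sym A′≡) swapped
  where
  S = removePair p A

  p≢q : p ≢ q
  p≢q refl = contradiction (trans (sym p∈A) q∉A) λ ()

  distinct : DistinctPairs ((p , false) ∷ (q , false) ∷ [])
  distinct = (p≢q ∷ []) ∷ [] ∷ []

  disjoint : PairsDisjoint S ((p , false) ∷ (q , false) ∷ [])
  disjoint = lookup∘update p A none ∷ trans (lookup∘update′ (≢-sym p≢q) A none) q∉A ∷ []

  open Frame S distinct disjoint using (⟦_⟧; addPair-frame; card-frame; skewCount-frame)

  A≡ : A ≡ ⟦ both ∷ none ∷ [] ⟧
  A≡ = begin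
    A                    ≡⟨ []≔-lookup A p ⟨
    A [ p ]≔ lookup A p  ≡⟨ cong (A [ p ]≔_) p∈A ⟩
    A [ p ]≔ both        ≡⟨ []≔-idempotent A p ⟨
    addPair p S          ≡⟨ cong (addPair p) (frame-∅ disjoint) ⟨
    addPair p ⟦ ∅ ⟧      ≡⟨ addPair-frame zero ∅ ⟩
    ⟦ both ∷ none ∷ [] ⟧ ∎
    where open ≡-Reasoning

  A′≡ : addPair q S ≡ ⟦ none ∷ both ∷ [] ⟧
  A′≡ = trans (cong (addPair q) (sym (frame-∅ disjoint))) (addPair-frame (suc zero) ∅)

  card-S : card S + 2 ≡ n
  card-S = trans (sym (card-frame (both ∷ none ∷ []))) (trans (cong card (sym A≡)) A-card)

  skewCount-S : skewCount S ≡ 0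
  skewCount-S = +-cancelʳ-≡ 1 _ 0
    (trans (sym (skewCount-frame (both ∷ none ∷ []))) (trans (cong skewCount (sym A≡)) A-skewCount))

  open Minor S distinct disjoint card-S skewCount-S using (almostTransversal-frame; minor-B2)

  swapped : almostMinus 𝓑 ⟦ both ∷ none ∷ [] ⟧ ⇔' almostMinus 𝓑 ⟦ none ∷ both ∷ [] ⟧
  swapped = almostMinus-⇔ {𝓑 = 𝓑} (proj₂ (almostTransversal-frame (both ∷ none ∷ [])) (refl , refl))
                                    (proj₂ (almostTransversal-frame (none ∷ both ∷ [])) (refl , refl))
                                    (minor-B2 M (pos ∷ pos ∷ []) (refl , refl) zero (suc zero) (λ ()))

almostMinus-allowable : ∀ {n} {𝓑 : Family n} → IsAntisymmetricMatroid 𝓑 → IsAllowable (almostMinus 𝓑)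
almostMinus-allowable M = (λ _ → proj₁) , almostMinus-swapPair M

a₀ b₀ c₀ : Elem 3
a₀ = zero , false
b₀ = suc zero , false
c₀ = suc (suc zero) , false

X₁ Y₁ X₂ Y₂ X₃ Y₃ : SubE 3
X₁ = ins3 a₀ b₀ c₀ ∅
Y₁ = ins3 b₀ (b₀ *) (c₀ *) ∅
X₂ = ins3 a₀ b₀ (c₀ *) ∅
Y₂ = ins3 b₀ (b₀ *) c₀ ∅
X₃ = ins3 a₀ b₀ (b₀ *) ∅
Y₃ = ins3 b₀ c₀ (c₀ *) ∅

module ThreePairs {𝓑 : Family 3} (M : IsAntisymmetricMatroid 𝓑) (allT : ∀ T → IsTransversal T → 𝓑 T) where
  open IsAntisymmetricMatroid M

  swapPairs : ∀ T → IsTransversal T → ∀ p q → p ≢ q →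
              𝓑 (removePair q (addPair p T)) → 𝓑 (removePair p (addPair q T))
  swapPairs T T-transversal p q p≢q = proj₁ (B2 T T-transversal p q p≢q)

  Y₁⇒Y₂⊎X₃ : 𝓑 Y₁ → 𝓑 Y₂ ⊎ 𝓑 X₃
  Y₁⇒Y₂⊎X₃ y₁ with Exch Y₁ X₁ y₁ (allT X₁ (refl , refl)) (b₀ *) refl (λ ()) refl refl
  ... | (zero , false)           , _  , _  , _ , y₂ = inj₁ y₂
  ... | (suc (suc zero) , false) , _  , _  , _ , x₃ = inj₂ x₃
  ... | (suc zero , false)       , _  , f∉ , _      = contradiction refl f∉
  ... | (zero , true)            , () , _
  ... | (suc zero , true)        , () , _
  ... | (suc (suc zero) , true)  , () , _

  Y₁⇒Y₂⊎Y₃ : 𝓑 Y₁ → 𝓑 Y₂ ⊎ 𝓑 Y₃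
  Y₁⇒Y₂⊎Y₃ y₁
    with Exch _ X₁ (swapPairs X₂ (refl , refl) (suc zero) zero (λ ()) y₁) (allT X₁ (refl , refl))
              (a₀ *) refl (λ ()) refl refl
  ... | (suc zero , false)       , _  , _  , _ , b = inj₁ (swapPairs X₁ (refl , refl) zero (suc zero) (λ ()) b)
  ... | (suc (suc zero) , false) , _  , _  , _ , b = inj₂ (swapPairs X₁ (refl , refl) zero (suc (suc zero)) (λ ()) b)
  ... | (zero , false)           , _  , f∉ , _     = contradiction refl f∉
  ... | (zero , true)            , () , _
  ... | (suc zero , true)        , () , _
  ... | (suc (suc zero) , true)  , () , _

  Y₁⇒Y₂⊎X₃Y₃ : 𝓑 Y₁ → 𝓑 Y₂ ⊎ (𝓑 X₃ × 𝓑 Y₃)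
  Y₁⇒Y₂⊎X₃Y₃ y₁ with Y₁⇒Y₂⊎X₃ y₁ | Y₁⇒Y₂⊎Y₃ y₁
  ... | inj₁ y₂ | _       = inj₁ y₂
  ... | inj₂ _  | inj₁ y₂ = inj₁ y₂
  ... | inj₂ x₃ | inj₂ y₃ = inj₂ (x₃ , y₃)

  X₃Y₃⇒Y₁⊎Y₂ : 𝓑 X₃ → 𝓑 Y₃ → 𝓑 Y₁ ⊎ 𝓑 Y₂
  X₃Y₃⇒Y₁⊎Y₂ x₃ y₃
    with Exch _ _ (swapPairs X₁ (refl , refl) (suc zero) (suc (suc zero)) (λ ()) x₃)
                  (swapPairs X₁ (refl , refl) (suc (suc zero)) zero (λ ()) y₃)
                  c₀ refl (λ ()) refl refl
  ... | (zero , true)            , _  , _  , b , _ = inj₁ (swapPairs X₂ (refl , refl) zero (suc zero) (λ ()) b)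
  ... | (suc zero , false)       , _  , _  , _ , b = inj₂ (swapPairs X₁ (refl , refl) zero (suc zero) (λ ()) b)
  ... | (zero , false)           , _  , f∉ , _     = contradiction refl f∉
  ... | (suc zero , true)        , () , _
  ... | (suc (suc zero) , false) , () , _
  ... | (suc (suc zero) , true)  , () , _

-- The minor along a₀ , b₀ , c₀ * relabels c ↔ c*: it interchanges X₁ ↔ X₂ and Y₁ ↔ Y₂ and fixes X₃ , Y₃.
Y₂⇒Y₁⊎X₃Y₃ : ∀ {𝓑 : Family 3} → IsAntisymmetricMatroid 𝓑 → (∀ T → IsTransversal T → 𝓑 T) →
             𝓑 Y₂ → 𝓑 Y₁ ⊎ (𝓑 X₃ × 𝓑 Y₃)
Y₂⇒Y₁⊎X₃Y₃ {𝓑} M allT =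
  ThreePairs.Y₁⇒Y₂⊎X₃Y₃ (minor-isAntisymmetricMatroid M (X₁ , allT X₂ (refl , refl)))
                        (λ T T-transversal → allT ⟦ T ⟧ (proj₂ (transversal-frame T) T-transversal))
  where
  open Minor ∅ {es = a₀ ∷ b₀ ∷ c₀ * ∷ []} (((λ ()) ∷ (λ ()) ∷ []) ∷ ((λ ()) ∷ []) ∷ [] ∷ [])
             (refl ∷ refl ∷ refl ∷ []) refl refl

edge-compatible₃ : ∀ {𝓑 : Family 3} → IsAntisymmetricMatroid 𝓑 → (∀ T → IsTransversal T → 𝓑 T) →
                   ¬ Incompatible (almostMinus 𝓑) ∅ a₀ b₀ c₀
edge-compatible₃ {𝓑} M allT =
  ¬ExactlyOne (¬Neither⇔ {𝓑 = 𝓑} (inj₂ x₁) (inj₁ (refl , refl)))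
              (¬Neither⇔ {𝓑 = 𝓑} (inj₂ x₂) (inj₁ (refl , refl)))
              (¬Neither⇔ {𝓑 = 𝓑} (inj₁ (refl , refl)) (inj₁ (refl , refl)))
              (λ (_ , y₁) → Sum.map₁ (x₂ ,_) (Y₁⇒Y₂⊎X₃Y₃ y₁))
              (λ (_ , y₂) → Sum.map₁ (x₁ ,_) (Y₂⇒Y₁⊎X₃Y₃ M allT y₂))
              (λ (x₃ , y₃) → Sum.map (x₁ ,_) (x₂ ,_) (X₃Y₃⇒Y₁⊎Y₂ x₃ y₃))
  where
  open ThreePairs M allT
  x₁ = allT X₁ (refl , refl)
  x₂ = allT X₂ (refl , refl)

module EdgeFrame {n} (S : SubE n) {a b c : Elem n} (a≢b : a ≢ b) (a≢c : a ≢ c) (b≢c : b ≢ c)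
                 (a∉S : ¬ (a ∈E S)) (b∉S : ¬ (b ∈E S)) (c∉S : ¬ (c ∈E S))
                 (abc-skewCount : skewCount (ins3 a b c S) ≡ 0) where

  private
    U  = ins3 a b c S
    cS = insertE c S

    a∈U : a ∈E U
    a∈U = ∈-insertE a (insertE b cS)

    b∈U : b ∈E U
    b∈U = ∈-insertE⁺ a (insertE b cS) b (∈-insertE b cS)

    c∈U : c ∈E U
    c∈U = ∈-insertE⁺ a (insertE b cS) c (∈-insertE⁺ b cS c (∈-insertE c S))

    S⊆U : ∀ x → x ∈E S → x ∈E U
    S⊆U x = ∈-insertE⁺ a (insertE b cS) x ∘ ∈-insertE⁺ b cS x ∘ ∈-insertE⁺ c S x

    no-skewPair : ∀ x → x ∈E U → ¬ ((x *) ∈E U)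
    no-skewPair x x∈ x*∈ = skewCount≡0⇒¬PairIn U (proj₁ x) abc-skewCount (∈-∈*⇒PairIn x U x∈ x*∈)

    distinctPair : ∀ x y → x ∈E U → y ∈E U → x ≢ y → proj₁ x ≢ proj₁ y
    distinctPair x y x∈ y∈ x≢y x~y = no-skewPair x x∈ (subst (_∈E U) (samePair⇒* x~y x≢y) y∈)

    disjointPair : ∀ x → x ∈E U → ¬ (x ∈E S) → PairDisjoint (proj₁ x) S
    disjointPair x x∈ x∉S = ∉-∉*⇒PairDisjoint x S x∉S (no-skewPair x x∈ ∘ S⊆U (x *))

  distinct : DistinctPairs (a ∷ b ∷ c ∷ [])
  distinct = (distinctPair a b a∈U b∈U a≢b ∷ distinctPair a c a∈U c∈U a≢c ∷ [])
           ∷ (distinctPair b c b∈U c∈U b≢c ∷ [])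
           ∷ [] ∷ []

  disjoint : PairsDisjoint S (a ∷ b ∷ c ∷ [])
  disjoint = disjointPair a a∈U a∉S ∷ disjointPair b b∈U b∉S ∷ disjointPair c c∈U c∉S ∷ []

edge-compatible : ∀ {n} {𝓑 : Family n} → IsAntisymmetricMatroid 𝓑 → (∀ T → IsTransversal T → 𝓑 T) →
  ∀ S a b c → a ≢ b → a ≢ c → b ≢ c → ¬ (a ∈E S) → ¬ (b ∈E S) → ¬ (c ∈E S) →
  IsTransversal (ins3 a b c S) → ¬ Incompatible (almostMinus 𝓑) S a b c
edge-compatible {n} {𝓑} M allT S a b c a≢b a≢c b≢c a∉S b∉S c∉S (abc-card , abc-skewCount) =
  edge-compatible₃ (minor-isAntisymmetricMatroid M (X₁ , allT′ X₁ (refl , refl))) allT′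
  ∘ ExactlyOne-map (Neither-frame 𝓑 a₀ b₀ c₀ b₀ (b₀ *) (c₀ *))
                   (Neither-frame 𝓑 a₀ b₀ (c₀ *) b₀ (b₀ *) c₀)
                   (Neither-frame 𝓑 a₀ b₀ (b₀ *) b₀ c₀ (c₀ *))
  where
  open EdgeFrame S a≢b a≢c b≢c a∉S b∉S c∉S abc-skewCount

  abc≡ : ins3 a b c S ≡ frame S (a ∷ b ∷ c ∷ []) X₁
  abc≡ = Frame.ins3-frame S distinct disjoint a₀ b₀ c₀

  card-S : card S + 3 ≡ n
  card-S = trans (sym (Frame.card-frame S distinct disjoint X₁)) (trans (cong card (sym abc≡)) abc-card)

  skewCount-S : skewCount S ≡ 0
  skewCount-S = trans (sym (+-identityʳ _))
    (trans (sym (Frame.skewCount-frame S distinct disjoint X₁)) (trans (cong skewCount (sym abc≡)) abc-skewCount))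

  open Minor S distinct disjoint card-S skewCount-S

  allT′ : ∀ T → IsTransversal T → 𝓑 ⟦ T ⟧
  allT′ T T-transversal = allT ⟦ T ⟧ (proj₂ (transversal-frame T) T-transversal)

proposition4p18 : ∀ (n : ℕ) (𝓑 : Family n) → IsAntisymmetricMatroid 𝓑 →
    (∀ T → IsTransversal T → 𝓑 T) → IsGaussoid (almostMinus 𝓑)
proposition4p18 n 𝓑 M allT = almostMinus-allowable M , edge-compatible M allT
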